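{- Let $f:\mathbf I\to\mathbf L$ be a homomorphism of involutive bisemilattices. Then the map $f^{\ast}:\widehat{\mathbf L}\to\widehat{\mathbf I}$, $f^{\ast}(\psi)=\psi\circ f$, is a morphism of GR spaces with involution (i.e. a GR morphism that preserves the involution).
   Context: Involutive bisemilattice: algebra $\langle B,\cdot,+,{}',0,1\rangle$ of type $(2,2,1,0,0)$ satisfying $x+x\approx x$; $x+y\approx y+x$; $x+(y+z)\approx(x+y)+z$; $(x')'\approx x$; $x\cdot y\approx(x'+y')'$; $x\cdot(x'+y)\approx x\cdot y$; $0+x\approx x$; $1\approx 0'$. $\mathbf 3$: universe $\{0,1,\alpha\}$, weak Kleene $\cdot,+$ ($\alpha$ absorbing, Boolean meet/join on $\{0,1\}$), $0'=1$, $1'=0$, $\alpha'=\alpha$; $x\le_\cdot y$ iff $x\cdot y=x$. On $\{0,1,\alpha\}$ put $a\ast b=a$ if $b\ne\alpha$ and $a\ast b=\alpha$ otherwise. For an involutive bisemilattice $\mathbf I$ with bisemilattice reduct $\mathbf S=\langle I,+,\cdot\rangle$, its dual $\widehat{\mathbf I}$ is the set of bisemilattice homomorphisms $\mathbf S\to\mathbf 3$, with pointwise operation $\ast$, pointwise order $\le_\cdot$, constants the constant maps with values $0,1,\alpha$ (called $c_0,c_1,c_\alpha$), the topology inherited from the product topology on $\{0,1,\alpha\}^I$ (discrete factors), and involution $(\neg\varphi)(x)=(\varphi(x'))'$. A GR morphism is a continuous map preserving $\ast$, the constants $c_0,c_1,c_\alpha$ and the order. -}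

module Defs where

open import Level using (Level; _⊔_; suc)
open import Data.List using (List)
open import Data.List.Membership.Propositional using (_∈_)
open import Data.Product using (Σ; ∃; _×_; _,_; proj₁; proj₂)
open import Relation.Binary.PropositionalEquality
  using (_≡_; refl; sym; trans; cong; cong₂)

record InvolutiveBisemilattice (ℓ : Level) : Set (suc ℓ) where
  infixl 6 _+_
  infixl 7 _·_
  field
    Carrier : Set ℓ
    _+_     : Carrier → Carrier → Carrier
    _·_     : Carrier → Carrier → Carrier
    _′      : Carrier → Carrier
    𝟘       : Carrier
    𝟙       : Carrier
    +-idem  : ∀ x → x + x ≡ x
    +-comm  : ∀ x y → x + y ≡ y + x
    +-assoc : ∀ x y z → x + (y + z) ≡ (x + y) + z
    ′-invol : ∀ x → (x ′) ′ ≡ x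
    ·-def   : ∀ x y → x · y ≡ ((x ′) + (y ′)) ′
    ·-abs   : ∀ x y → x · ((x ′) + y) ≡ x · y
    +-idl   : ∀ x → 𝟘 + x ≡ x
    𝟙-def   : 𝟙 ≡ 𝟘 ′

open InvolutiveBisemilattice

record IsHom {a b} (I : InvolutiveBisemilattice a) (L : InvolutiveBisemilattice b)
             (f : Carrier I → Carrier L) : Set (a ⊔ b) where
  field
    pres-+ : ∀ x y → f (_+_ I x y) ≡ _+_ L (f x) (f y)
    pres-· : ∀ x y → f (_·_ I x y) ≡ _·_ L (f x) (f y)
    pres-′ : ∀ x → f (_′ I x) ≡ _′ L (f x)
    pres-0 : f (𝟘 I) ≡ 𝟘 L
    pres-1 : f (𝟙 I) ≡ 𝟙 L

data Three : Set where
  t0 t1 tα : Three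

_⊕_ : Three → Three → Three
tα ⊕ _  = tα
_  ⊕ tα = tα
t0 ⊕ t0 = t0
t0 ⊕ t1 = t1
t1 ⊕ t0 = t1
t1 ⊕ t1 = t1

_⊙_ : Three → Three → Three
tα ⊙ _  = tα
_  ⊙ tα = tα
t0 ⊙ t0 = t0
t0 ⊙ t1 = t0
t1 ⊙ t0 = t0
t1 ⊙ t1 = t1

~_ : Three → Three
~ t0 = t1
~ t1 = t0
~ tα = tα

_⋆_ : Three → Three → Three
a ⋆ tα = tα
a ⋆ t0 = a
a ⋆ t1 = a

_≤·_ : Three → Three → Set
x ≤· y = x ⊙ y ≡ x

record IsBisemHom {a} (I : InvolutiveBisemilattice a) (φ : Carrier I → Three) : Set a where
  field
    hom-+ : ∀ x y → φ (_+_ I x y) ≡ φ x ⊕ φ y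
    hom-· : ∀ x y → φ (_·_ I x y) ≡ φ x ⊙ φ y

Dual : ∀ {a} → InvolutiveBisemilattice a → Set a
Dual I = Σ (Carrier I → Three) (IsBisemHom I)

private
  ⋆-⊕ : ∀ a b c d → (a ⊕ b) ⋆ (c ⊕ d) ≡ (a ⋆ c) ⊕ (b ⋆ d)
  ⋆-⊕ t0 t0 t0 t0 = refl
  ⋆-⊕ t0 t0 t0 t1 = refl
  ⋆-⊕ t0 t0 t0 tα = refl
  ⋆-⊕ t0 t0 t1 t0 = refl
  ⋆-⊕ t0 t0 t1 t1 = refl
  ⋆-⊕ t0 t0 t1 tα = refl
  ⋆-⊕ t0 t0 tα d = refl
  ⋆-⊕ t0 t1 t0 t0 = refl
  ⋆-⊕ t0 t1 t0 t1 = refl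
  ⋆-⊕ t0 t1 t0 tα = refl
  ⋆-⊕ t0 t1 t1 t0 = refl
  ⋆-⊕ t0 t1 t1 t1 = refl
  ⋆-⊕ t0 t1 t1 tα = refl
  ⋆-⊕ t0 t1 tα d = refl
  ⋆-⊕ t0 tα t0 t0 = refl
  ⋆-⊕ t0 tα t0 t1 = refl
  ⋆-⊕ t0 tα t0 tα = refl
  ⋆-⊕ t0 tα t1 t0 = refl
  ⋆-⊕ t0 tα t1 t1 = refl
  ⋆-⊕ t0 tα t1 tα = refl
  ⋆-⊕ t0 tα tα d = refl
  ⋆-⊕ t1 t0 t0 t0 = refl
  ⋆-⊕ t1 t0 t0 t1 = refl
  ⋆-⊕ t1 t0 t0 tα = refl
  ⋆-⊕ t1 t0 t1 t0 = refl
  ⋆-⊕ t1 t0 t1 t1 = refl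
  ⋆-⊕ t1 t0 t1 tα = refl
  ⋆-⊕ t1 t0 tα d = refl
  ⋆-⊕ t1 t1 t0 t0 = refl
  ⋆-⊕ t1 t1 t0 t1 = refl
  ⋆-⊕ t1 t1 t0 tα = refl
  ⋆-⊕ t1 t1 t1 t0 = refl
  ⋆-⊕ t1 t1 t1 t1 = refl
  ⋆-⊕ t1 t1 t1 tα = refl
  ⋆-⊕ t1 t1 tα d = refl
  ⋆-⊕ t1 tα t0 t0 = refl
  ⋆-⊕ t1 tα t0 t1 = refl
  ⋆-⊕ t1 tα t0 tα = refl
  ⋆-⊕ t1 tα t1 t0 = refl
  ⋆-⊕ t1 tα t1 t1 = refl
  ⋆-⊕ t1 tα t1 tα = refl
  ⋆-⊕ t1 tα tα d = refl
  ⋆-⊕ tα b t0 t0 = refl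
  ⋆-⊕ tα b t0 t1 = refl
  ⋆-⊕ tα b t0 tα = refl
  ⋆-⊕ tα b t1 t0 = refl
  ⋆-⊕ tα b t1 t1 = refl
  ⋆-⊕ tα b t1 tα = refl
  ⋆-⊕ tα b tα d = refl

  ⋆-⊙ : ∀ a b c d → (a ⊙ b) ⋆ (c ⊙ d) ≡ (a ⋆ c) ⊙ (b ⋆ d)
  ⋆-⊙ t0 t0 t0 t0 = refl
  ⋆-⊙ t0 t0 t0 t1 = refl
  ⋆-⊙ t0 t0 t0 tα = refl
  ⋆-⊙ t0 t0 t1 t0 = refl
  ⋆-⊙ t0 t0 t1 t1 = refl
  ⋆-⊙ t0 t0 t1 tα = refl
  ⋆-⊙ t0 t0 tα d = refl
  ⋆-⊙ t0 t1 t0 t0 = refl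
  ⋆-⊙ t0 t1 t0 t1 = refl
  ⋆-⊙ t0 t1 t0 tα = refl
  ⋆-⊙ t0 t1 t1 t0 = refl
  ⋆-⊙ t0 t1 t1 t1 = refl
  ⋆-⊙ t0 t1 t1 tα = refl
  ⋆-⊙ t0 t1 tα d = refl
  ⋆-⊙ t0 tα t0 t0 = refl
  ⋆-⊙ t0 tα t0 t1 = refl
  ⋆-⊙ t0 tα t0 tα = refl
  ⋆-⊙ t0 tα t1 t0 = refl
  ⋆-⊙ t0 tα t1 t1 = refl
  ⋆-⊙ t0 tα t1 tα = refl
  ⋆-⊙ t0 tα tα d = refl
  ⋆-⊙ t1 t0 t0 t0 = refl
  ⋆-⊙ t1 t0 t0 t1 = refl
  ⋆-⊙ t1 t0 t0 tα = refl
  ⋆-⊙ t1 t0 t1 t0 = refl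
  ⋆-⊙ t1 t0 t1 t1 = refl
  ⋆-⊙ t1 t0 t1 tα = refl
  ⋆-⊙ t1 t0 tα d = refl
  ⋆-⊙ t1 t1 t0 t0 = refl
  ⋆-⊙ t1 t1 t0 t1 = refl
  ⋆-⊙ t1 t1 t0 tα = refl
  ⋆-⊙ t1 t1 t1 t0 = refl
  ⋆-⊙ t1 t1 t1 t1 = refl
  ⋆-⊙ t1 t1 t1 tα = refl
  ⋆-⊙ t1 t1 tα d = refl
  ⋆-⊙ t1 tα t0 t0 = refl
  ⋆-⊙ t1 tα t0 t1 = refl
  ⋆-⊙ t1 tα t0 tα = refl
  ⋆-⊙ t1 tα t1 t0 = refl
  ⋆-⊙ t1 tα t1 t1 = refl
  ⋆-⊙ t1 tα t1 tα = refl
  ⋆-⊙ t1 tα tα d = refl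
  ⋆-⊙ tα b t0 t0 = refl
  ⋆-⊙ tα b t0 t1 = refl
  ⋆-⊙ tα b t0 tα = refl
  ⋆-⊙ tα b t1 t0 = refl
  ⋆-⊙ tα b t1 t1 = refl
  ⋆-⊙ tα b t1 tα = refl
  ⋆-⊙ tα b tα d = refl

  ~-⊙ : ∀ a b → ~ (a ⊙ b) ≡ (~ a) ⊕ (~ b)
  ~-⊙ t0 t0 = refl
  ~-⊙ t0 t1 = refl
  ~-⊙ t0 tα = refl
  ~-⊙ t1 t0 = refl
  ~-⊙ t1 t1 = refl
  ~-⊙ t1 tα = refl
  ~-⊙ tα b = refl

  ~-⊕ : ∀ a b → ~ (a ⊕ b) ≡ (~ a) ⊙ (~ b)
  ~-⊕ t0 t0 = refl
  ~-⊕ t0 t1 = refl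
  ~-⊕ t0 tα = refl
  ~-⊕ t1 t0 = refl
  ~-⊕ t1 t1 = refl
  ~-⊕ t1 tα = refl
  ~-⊕ tα b = refl

  ⊕-idem : ∀ a → a ⊕ a ≡ a
  ⊕-idem t0 = refl
  ⊕-idem t1 = refl
  ⊕-idem tα = refl

  ⊙-idem : ∀ a → a ⊙ a ≡ a
  ⊙-idem t0 = refl
  ⊙-idem t1 = refl
  ⊙-idem tα = refl

_⋆̂_ : ∀ {a} {I : InvolutiveBisemilattice a} → Dual I → Dual I → Dual I
_⋆̂_ {I = I} (φ , hφ) (ψ , hψ) = (λ x → φ x ⋆ ψ x) , record
  { hom-+ = λ x y → trans (cong₂ _⋆_ (IsBisemHom.hom-+ hφ x y) (IsBisemHom.hom-+ hψ x y))
                          (⋆-⊕ (φ x) (φ y) (ψ x) (ψ y))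
  ; hom-· = λ x y → trans (cong₂ _⋆_ (IsBisemHom.hom-· hφ x y) (IsBisemHom.hom-· hψ x y))
                          (⋆-⊙ (φ x) (φ y) (ψ x) (ψ y))
  }

const̂ : ∀ {a} {I : InvolutiveBisemilattice a} → Three → Dual I
const̂ v = (λ _ → v) , record { hom-+ = λ _ _ → sym (⊕-idem v) ; hom-· = λ _ _ → sym (⊙-idem v) }

¬̂ : ∀ {a} {I : InvolutiveBisemilattice a} → Dual I → Dual I
¬̂ {I = I} (φ , hφ) = (λ x → ~ φ (_′ I x)) , record
  { hom-+ = λ x y → trans (cong (λ z → ~ φ z) (′+ x y))
                      (trans (cong ~_ (IsBisemHom.hom-· hφ (_′ I x) (_′ I y)))
                             (~-⊙ (φ (_′ I x)) (φ (_′ I y))))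
  ; hom-· = λ x y → trans (cong (λ z → ~ φ z) (′· x y))
                      (trans (cong ~_ (IsBisemHom.hom-+ hφ (_′ I x) (_′ I y)))
                             (~-⊕ (φ (_′ I x)) (φ (_′ I y))))
  }
  where
  ′· : ∀ x y → _′ I (_·_ I x y) ≡ _+_ I (_′ I x) (_′ I y)
  ′· x y = trans (cong (_′ I) (·-def I x y)) (′-invol I _)
  ′+ : ∀ x y → _′ I (_+_ I x y) ≡ _·_ I (_′ I x) (_′ I y)
  ′+ x y = sym (trans (·-def I (_′ I x) (_′ I y))
                      (cong₂ (λ u v → _′ I (_+_ I u v)) (′-invol I x) (′-invol I y)))

_≤̂_ : ∀ {a} {I : InvolutiveBisemilattice a} → Dual I → Dual I → Set a
_≤̂_ (φ , _) (ψ , _) = ∀ x → φ x ≤· ψ x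

_≈̂_ : ∀ {a} {I : InvolutiveBisemilattice a} → Dual I → Dual I → Set a
_≈̂_ (φ , _) (ψ , _) = ∀ x → φ x ≡ ψ x

-- Continuity w.r.t. the subspace topology inherited from the product
-- topology on {0,1,α}^I (discrete factors).  Preimages of the subbasic
-- opens {χ | χ(i) = v} must be open, i.e. every point of such a preimage
-- has a basic neighbourhood (determined by finitely many coordinates)
-- inside it.

Continuous : ∀ {a b} (L : InvolutiveBisemilattice b) (I : InvolutiveBisemilattice a)
             → (Dual L → Dual I) → Set (a ⊔ b)
Continuous L I F =
  ∀ (i : Carrier I) (v : Three) (ψ : Dual L) → proj₁ (F ψ) i ≡ v →
  ∃ λ (G : List (Carrier L)) →
    ∀ (ψ′ : Dual L) → (∀ {l} → l ∈ G → proj₁ ψ′ l ≡ proj₁ ψ l) → proj₁ (F ψ′) i ≡ v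

record IsGRMorphismWithInvolution {a b} (L : InvolutiveBisemilattice b)
       (I : InvolutiveBisemilattice a) (F : Dual L → Dual I) : Set (suc (a ⊔ b)) where
  field
    continuous : Continuous L I F
    pres-⋆     : ∀ φ ψ → F (_⋆̂_ {I = L} φ ψ) ≈̂ _⋆̂_ {I = I} (F φ) (F ψ)
    pres-c₀    : F (const̂ t0) ≈̂ const̂ {I = I} t0
    pres-c₁    : F (const̂ t1) ≈̂ const̂ {I = I} t1
    pres-cα    : F (const̂ tα) ≈̂ const̂ {I = I} tα
    pres-≤     : ∀ φ ψ → _≤̂_ {I = L} φ ψ → _≤̂_ {I = I} (F φ) (F ψ)
    pres-¬     : ∀ φ → F (¬̂ {I = L} φ) ≈̂ ¬̂ {I = I} (F φ)

dualMap : ∀ {a b} {I : InvolutiveBisemilattice a} {L : InvolutiveBisemilattice b}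
          (f : Carrier I → Carrier L) → IsHom I L f → Dual L → Dual I
dualMap f hf (ψ , hψ) = (λ x → ψ (f x)) , record
  { hom-+ = λ x y → trans (cong ψ (IsHom.pres-+ hf x y)) (IsBisemHom.hom-+ hψ (f x) (f y))
  ; hom-· = λ x y → trans (cong ψ (IsHom.pres-· hf x y)) (IsBisemHom.hom-· hψ (f x) (f y))
  }

module Submission where

-- The dual map f* sends ψ to ψ ∘ f, so the value of f*(ψ) at
-- a point x of I is the value of ψ at the single point f x of L.  All the
-- structure on the dual spaces (the operation ∗, the constants, the order,
-- the subbasic opens of the product topology) is defined pointwise, so it
-- is preserved by any map that acts on coordinates in this way:
--   * continuity: a map whose i-th output coordinate is the g(i)-th input
--     coordinate is continuous, since the preimage of {χ | χ(i) = v} is the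
--     subbasic open {ψ | ψ(g i) = v} (lemma coordinate-map-continuous);
--   * ∗, c₀, c₁, c_α and ≤ are preserved pointwise, definitionally;
--   * the involution is preserved because f commutes with ′, which is the
--     only place where the homomorphism property of f enters
--     (lemma dualMap-pres-¬).

open import Defs
open import Data.List using ([_])
open import Data.List.Relation.Unary.Any using (here)
open import Data.Product using (_,_; proj₁)
open import Relation.Binary.PropositionalEquality using (_≡_; refl; sym; cong; module ≡-Reasoning)

open InvolutiveBisemilattice using (Carrier)

-- A map between dual spaces whose output at i is the input at g i is
-- continuous: the single coordinate g i forms a finite neighbourhood
-- determining the i-th output coordinate.
coordinate-map-continuous :
  ∀ {a b} (L : InvolutiveBisemilattice b) (I : InvolutiveBisemilattice a)
  (F : Dual L → Dual I) (g : Carrier I → Carrier L) →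
  (∀ ψ i → proj₁ (F ψ) i ≡ proj₁ ψ (g i)) →
  Continuous L I F
coordinate-map-continuous L I F g F-at i v ψ Fψi≡v =
  [ g i ] , λ ψ′ ψ′≈ψ-on-gi → agreeing-at-g-i ψ′ (ψ′≈ψ-on-gi (here refl))
  where
  agreeing-at-g-i : ∀ ψ′ → proj₁ ψ′ (g i) ≡ proj₁ ψ (g i) → proj₁ (F ψ′) i ≡ v
  agreeing-at-g-i ψ′ agree = begin
    proj₁ (F ψ′) i  ≡⟨ F-at ψ′ i ⟩
    proj₁ ψ′ (g i)  ≡⟨ agree ⟩
    proj₁ ψ (g i)   ≡⟨ sym (F-at ψ i) ⟩
    proj₁ (F ψ) i   ≡⟨ Fψi≡v ⟩
    v               ∎
    where open ≡-Reasoning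

-- f* preserves the involution: (¬ψ ∘ f)(x) = ψ((f x)′)′ = ψ(f(x′))′ = ¬(ψ ∘ f)(x),
-- using that f commutes with ′.
dualMap-pres-¬ :
  ∀ {a b} {I : InvolutiveBisemilattice a} {L : InvolutiveBisemilattice b}
  (f : Carrier I → Carrier L) (hf : IsHom I L f) (ψ : Dual L) →
  dualMap f hf (¬̂ {I = L} ψ) ≈̂ ¬̂ {I = I} (dualMap f hf ψ)
dualMap-pres-¬ f hf (ψ , _) x = cong (λ y → ~ ψ y) (sym (IsHom.pres-′ hf x))

proposition4p16 : ∀ {a b} (I : InvolutiveBisemilattice a) (L : InvolutiveBisemilattice b)
    (f : InvolutiveBisemilattice.Carrier I → InvolutiveBisemilattice.Carrier L)
    (hf : IsHom I L f) →
    IsGRMorphismWithInvolution L I (dualMap f hf)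
proposition4p16 I L f hf = record
  { continuous = coordinate-map-continuous L I (dualMap f hf) f (λ _ _ → refl)
  ; pres-⋆     = λ φ ψ x → refl
  ; pres-c₀    = λ x → refl
  ; pres-c₁    = λ x → refl
  ; pres-cα    = λ x → refl
  ; pres-≤     = λ φ ψ φ≤ψ x → φ≤ψ (f x)
  ; pres-¬     = dualMap-pres-¬ f hf
  }
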